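{- Let $n,m$ be positive integers with $\delta(n)=\delta(m)$. If $n$ is stable, then $m$ is stable.
   Context: $\|n\|$ is the complexity of a positive integer $n$: the least number of $1$'s needed to write $n$ using $1$, $+$, $\times$ and parentheses; $\delta(n)=\|n\|-3\log_3 n$ is its defect. A positive integer $m$ is stable if $\|3^km\|=3k+\|m\|$ for every $k\ge1$ (equivalently $\delta(3^km)=\delta(m)$ for every $k\ge1$). -}

module Defs where

open import Data.Nat using (ℕ; zero; suc; _+_; _*_; _^_; _≤_; _<_)
open import Data.Product using (Σ; _×_)
open import Relation.Binary.PropositionalEquality using (_≡_)

data Expr : Set where
  one  : Expr
  _⊕_  : Expr → Expr → Expr
  _⊗_  : Expr → Expr → Expr

eval : Expr → ℕ
eval one       = 1
eval (e ⊕ f)   = eval e + eval f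
eval (e ⊗ f)   = eval e * eval f

ones : Expr → ℕ
ones one       = 1
ones (e ⊕ f)   = ones e + ones f
ones (e ⊗ f)   = ones e + ones f

IsComplexity : ℕ → ℕ → Set
IsComplexity n c =
  Σ Expr (λ e → eval e ≡ n × ones e ≡ c) × ((e : Expr) → eval e ≡ n → c ≤ ones e)

-- δ(n) = δ(m), given ‖n‖ = cn and ‖m‖ = cm.
-- δ(n) = δ(m) ⇔ cn − 3 log₃ n = cm − 3 log₃ m ⇔ 3^cn / n³ = 3^cm / m³
-- ⇔ 3^cn · m³ = 3^cm · n³  (exponentiating; all quantities positive).
SameDefect : (n m cn cm : ℕ) → Set
SameDefect n m cn cm = 3 ^ cn * m ^ 3 ≡ 3 ^ cm * n ^ 3

Stable : ℕ → Set
Stable m = (k : ℕ) → 1 ≤ k → (c : ℕ) → IsComplexity m c → IsComplexity (3 ^ k * m) (3 * k + c)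

{-# OPTIONS --safe #-}
-- Equal defect means 3 ^ ‖n‖ * m ^ 3 = 3 ^ ‖m‖ * n ^ 3. Comparing the powers of 3 on both
-- sides (write x = 3 ^ v * u with 3 ∤ u, uniquely) forces n = 3 ^ q * m and ‖n‖ = ‖m‖ + 3q,
-- or the same with n and m swapped. Stability transfers along multiplication by 3 ^ q in
-- both directions: upwards since 3 ^ k * (3 ^ q * m) = 3 ^ (k + q) * m, downwards since
-- prefixing 3 ^ q to an expression for 3 ^ k * m costs 3q ones and yields an expression
-- for 3 ^ k * n, whose complexity 3k + ‖n‖ is known.
module Submission where

open import Defs
open import Data.Nat
  using (ℕ; zero; suc; _+_; _*_; _^_; _≤_; _<_; NonZero; >-nonZero; nonTrivial⇒n>1)
open import Data.Nat.Properties
open import Data.Nat.Divisibility using (_∣_; _∤_; _∣?_; divides; ∣1⇒≡1; ∣m⇒∣m*n; m∣m*n)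
open import Data.Nat.Induction using (<-wellFounded)
open import Data.Nat.Primality
  using (Prime; prime?; ¬prime[1]; prime⇒nonZero; prime⇒nonTrivial; euclidsLemma)
open import Data.Nat.Tactic.RingSolver using (solve-∀)
open import Algebra.Properties.CommutativeSemigroup *-commutativeSemigroup
  using (x∙yz≈y∙xz) renaming (interchange to *-interchange)
open import Data.Product using (∃; ∃₂; _×_; _,_; proj₂; map₁)
open import Data.Sum using (_⊎_; inj₁; inj₂; [_,_]′)
open import Induction.WellFounded using (Acc; acc)
open import Relation.Binary.Definitions using (tri<; tri≈; tri>)
open import Relation.Binary.PropositionalEquality
open import Relation.Nullary using (yes; no; contradiction)
open import Relation.Nullary.Decidable using (from-yes)

^-distribʳ-* : ∀ m n o → (m * n) ^ o ≡ m ^ o * n ^ o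
^-distribʳ-* m n zero    = refl
^-distribʳ-* m n (suc o) = begin
  m * n * (m * n) ^ o      ≡⟨ cong (m * n *_) (^-distribʳ-* m n o) ⟩
  m * n * (m ^ o * n ^ o)  ≡⟨ *-interchange m n (m ^ o) (n ^ o) ⟩
  m * m ^ o * (n * n ^ o)  ∎
  where open ≡-Reasoning

^-cancelʳ-≡ : ∀ m n o .{{_ : NonZero o}} → m ^ o ≡ n ^ o → m ≡ n
^-cancelʳ-≡ m n o eq with <-cmp m n
... | tri< m<n _ _ = contradiction eq (<⇒≢ (^-monoˡ-< o m<n))
... | tri≈ _ m≡n _ = m≡n
... | tri> _ _ m>n = contradiction eq (≢-sym (<⇒≢ (^-monoˡ-< o m>n)))

m^a*[m^v*u]^k≡m^[a+v*k]*u^k : ∀ m a v u k → m ^ a * (m ^ v * u) ^ k ≡ m ^ (a + v * k) * u ^ k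
m^a*[m^v*u]^k≡m^[a+v*k]*u^k m a v u k = begin
  m ^ a * (m ^ v * u) ^ k        ≡⟨ cong (m ^ a *_) (^-distribʳ-* (m ^ v) u k) ⟩
  m ^ a * ((m ^ v) ^ k * u ^ k)  ≡⟨ cong (λ z → m ^ a * (z * u ^ k)) (^-*-assoc m v k) ⟩
  m ^ a * (m ^ (v * k) * u ^ k)  ≡⟨ *-assoc (m ^ a) (m ^ (v * k)) (u ^ k) ⟨
  m ^ a * m ^ (v * k) * u ^ k    ≡⟨ cong (_* u ^ k) (^-distribˡ-+-* m a (v * k)) ⟨
  m ^ (a + v * k) * u ^ k        ∎
  where open ≡-Reasoning

m^[v+q]*u≡m^q*[m^v*u] : ∀ m v q u → m ^ (v + q) * u ≡ m ^ q * (m ^ v * u)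
m^[v+q]*u≡m^q*[m^v*u] m v q u = begin
  m ^ (v + q) * u      ≡⟨ cong (_* u) (^-distribˡ-+-* m v q) ⟩
  m ^ v * m ^ q * u    ≡⟨ cong (_* u) (*-comm (m ^ v) (m ^ q)) ⟩
  m ^ q * m ^ v * u    ≡⟨ *-assoc (m ^ q) (m ^ v) u ⟩
  m ^ q * (m ^ v * u)  ∎
  where open ≡-Reasoning

a+v*k≡b+[v+q]*k⇒a≡b+k*q : ∀ {a b} v q k → a + v * k ≡ b + (v + q) * k → a ≡ b + k * q
a+v*k≡b+[v+q]*k⇒a≡b+k*q {a} {b} v q k eq =
  +-cancelʳ-≡ (v * k) a (b + k * q) (trans eq (regroup b v q k))
  where
  regroup : ∀ b v q k → b + (v + q) * k ≡ b + k * q + v * k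
  regroup = solve-∀

module _ {p : ℕ} (p-prime : Prime p) where

  private instance
    p≢0 : NonZero p
    p≢0 = prime⇒nonZero p-prime

  p∤⇒p∤^ : ∀ {m} n → p ∤ m → p ∤ m ^ n
  p∤⇒p∤^ zero    p∤m p∣1     = ¬prime[1] (subst Prime (∣1⇒≡1 p∣1) p-prime)
  p∤⇒p∤^ (suc n) p∤m p∣m^1+n = [ p∤m , p∤⇒p∤^ n p∤m ]′ (euclidsLemma _ _ p-prime p∣m^1+n)

  p^i*s≡p^j*t⇒i≡j∧s≡t : ∀ i j {s t} → p ∤ s → p ∤ t → p ^ i * s ≡ p ^ j * t → i ≡ j × s ≡ t
  p^i*s≡p^j*t⇒i≡j∧s≡t zero    zero    {s} {t} _   _   eq =
    refl , trans (sym (*-identityˡ s)) (trans eq (*-identityˡ t))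
  p^i*s≡p^j*t⇒i≡j∧s≡t zero    (suc j) {s} {t} p∤s _   eq =
    contradiction (subst (p ∣_) (trans (sym eq) (*-identityˡ s)) (∣m⇒∣m*n t (m∣m*n (p ^ j)))) p∤s
  p^i*s≡p^j*t⇒i≡j∧s≡t (suc i) zero    {s} {t} _   p∤t eq =
    contradiction (subst (p ∣_) (trans eq (*-identityˡ t)) (∣m⇒∣m*n s (m∣m*n (p ^ i)))) p∤t
  p^i*s≡p^j*t⇒i≡j∧s≡t (suc i) (suc j) {s} {t} p∤s p∤t eq =
    map₁ (cong suc) (p^i*s≡p^j*t⇒i≡j∧s≡t i j p∤s p∤t (*-cancelˡ-≡ _ _ p p*[p^i*s]≡p*[p^j*t]))
    where
    p*[p^i*s]≡p*[p^j*t] : p * (p ^ i * s) ≡ p * (p ^ j * t)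
    p*[p^i*s]≡p*[p^j*t] = trans (sym (*-assoc p (p ^ i) s)) (trans eq (*-assoc p (p ^ j) t))

  p-factorisation : ∀ m .{{_ : NonZero m}} → ∃₂ λ v u → m ≡ p ^ v * u × p ∤ u
  p-factorisation m = go m (<-wellFounded m)
    where
    p*-factorisation : ∀ {q} → ∃₂ (λ v u → q ≡ p ^ v * u × p ∤ u) →
                       ∃₂ (λ v u → q * p ≡ p ^ v * u × p ∤ u)
    p*-factorisation (v , u , refl , p∤u) =
      suc v , u , trans (*-comm (p ^ v * u) p) (sym (*-assoc p (p ^ v) u)) , p∤u

    go : ∀ m .{{_ : NonZero m}} → Acc _<_ m → ∃₂ λ v u → m ≡ p ^ v * u × p ∤ u
    go m (acc rec) with p ∣? m
    ... | no p∤m               = 0 , m , sym (*-identityˡ m) , p∤m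
    ... | yes (divides q refl) = p*-factorisation (go q (rec (m<m*n q p (nonTrivial⇒n>1 p))))
      where instance
        _ = m*n≢0⇒m≢0 q
        _ = prime⇒nonTrivial p-prime

  p^a*x^k≡p^b*y^k⇒y≡p^q*x∨x≡p^q*y :
    ∀ k .{{_ : NonZero k}} {a b x y} .{{_ : NonZero x}} .{{_ : NonZero y}} →
    p ^ a * x ^ k ≡ p ^ b * y ^ k →
    ∃ λ q → (a ≡ b + k * q × y ≡ p ^ q * x) ⊎ (b ≡ a + k * q × x ≡ p ^ q * y)
  p^a*x^k≡p^b*y^k⇒y≡p^q*x∨x≡p^q*y k {a} {b} {x} {y} eq
    with v , u , refl , p∤u ← p-factorisation x
    with w , t , refl , p∤t ← p-factorisation y
    with a+v*k≡b+w*k , u^k≡t^k ←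
           p^i*s≡p^j*t⇒i≡j∧s≡t (a + v * k) (b + w * k) (p∤⇒p∤^ k p∤u) (p∤⇒p∤^ k p∤t)
             (trans (sym (m^a*[m^v*u]^k≡m^[a+v*k]*u^k p a v u k))
                    (trans eq (m^a*[m^v*u]^k≡m^[a+v*k]*u^k p b w t k)))
    with refl ← ^-cancelʳ-≡ u t k u^k≡t^k
    with ≤-total v w
  ... | inj₁ v≤w with q , refl ← m≤n⇒∃[o]m+o≡n v≤w =
    q , inj₁ (a+v*k≡b+[v+q]*k⇒a≡b+k*q v q k a+v*k≡b+w*k , m^[v+q]*u≡m^q*[m^v*u] p v q u)
  ... | inj₂ w≤v with q , refl ← m≤n⇒∃[o]m+o≡n w≤v =
    q , inj₂ (a+v*k≡b+[v+q]*k⇒a≡b+k*q w q k (sym a+v*k≡b+w*k) , m^[v+q]*u≡m^q*[m^v*u] p w q u)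

complexity-unique : ∀ {n c c′} → IsComplexity n c → IsComplexity n c′ → c ≡ c′
complexity-unique ((e , eval-e , ones-e) , minimal) ((e′ , eval-e′ , ones-e′) , minimal′) =
  ≤-antisym (subst (_ ≤_) ones-e′ (minimal e′ eval-e′)) (subst (_ ≤_) ones-e (minimal′ e eval-e))

3^_⊗_ : ℕ → Expr → Expr
3^ zero  ⊗ e = e
3^ suc k ⊗ e = ((one ⊕ one) ⊕ one) ⊗ (3^ k ⊗ e)

eval-3^⊗ : ∀ k e → eval (3^ k ⊗ e) ≡ 3 ^ k * eval e
eval-3^⊗ zero    e = sym (*-identityˡ (eval e))
eval-3^⊗ (suc k) e = trans (cong (3 *_) (eval-3^⊗ k e)) (sym (*-assoc 3 (3 ^ k) (eval e)))

ones-3^⊗ : ∀ k e → ones (3^ k ⊗ e) ≡ 3 * k + ones e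
ones-3^⊗ zero    e = refl
ones-3^⊗ (suc k) e = begin
  3 + ones (3^ k ⊗ e)   ≡⟨ cong (3 +_) (ones-3^⊗ k e) ⟩
  3 + (3 * k + ones e)  ≡⟨ +-assoc 3 (3 * k) (ones e) ⟨
  3 + 3 * k + ones e    ≡⟨ cong (_+ ones e) (*-suc 3 k) ⟨
  3 * suc k + ones e    ∎
  where open ≡-Reasoning

stable⇒stable-3^* : ∀ q {m c} → IsComplexity m c → IsComplexity (3 ^ q * m) (c + 3 * q) →
                    Stable m → Stable (3 ^ q * m)
stable⇒stable-3^* q {m} {c} ‖m‖ ‖3^q*m‖ stable k 1≤k c′ ‖3^q*m‖′
  with refl ← complexity-unique ‖3^q*m‖′ ‖3^q*m‖ =
  subst₂ IsComplexity 3^[k+q]*m≡3^k*[3^q*m] (regroup k q c)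
    (stable (k + q) (≤-trans 1≤k (m≤m+n k q)) c ‖m‖)
  where
  3^[k+q]*m≡3^k*[3^q*m] : 3 ^ (k + q) * m ≡ 3 ^ k * (3 ^ q * m)
  3^[k+q]*m≡3^k*[3^q*m] = trans (cong (_* m) (^-distribˡ-+-* 3 k q)) (*-assoc (3 ^ k) (3 ^ q) m)
  regroup : ∀ k q c → 3 * (k + q) + c ≡ 3 * k + (c + 3 * q)
  regroup = solve-∀

stable-3^*⇒stable : ∀ q {m c} → IsComplexity m c → IsComplexity (3 ^ q * m) (c + 3 * q) →
                    Stable (3 ^ q * m) → Stable m
stable-3^*⇒stable q {m} {c} ‖m‖@((e , eval-e , ones-e) , _) ‖3^q*m‖ stable k 1≤k c′ ‖m‖′
  with refl ← complexity-unique ‖m‖′ ‖m‖ =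
  (3^ k ⊗ e , trans (eval-3^⊗ k e) (cong (3 ^ k *_) eval-e) ,
              trans (ones-3^⊗ k e) (cong (3 * k +_) ones-e)) ,
  minimal
  where
  regroup : ∀ k q c → 3 * q + (3 * k + c) ≡ 3 * k + (c + 3 * q)
  regroup = solve-∀
  minimal : ∀ e′ → eval e′ ≡ 3 ^ k * m → 3 * k + c ≤ ones e′
  minimal e′ eval-e′ = +-cancelˡ-≤ (3 * q) _ _ (begin
    3 * q + (3 * k + c)  ≡⟨ regroup k q c ⟩
    3 * k + (c + 3 * q)  ≤⟨ proj₂ (stable k 1≤k (c + 3 * q) ‖3^q*m‖) (3^ q ⊗ e′) eval-3^q⊗e′ ⟩
    ones (3^ q ⊗ e′)     ≡⟨ ones-3^⊗ q e′ ⟩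
    3 * q + ones e′      ∎)
    where
    open ≤-Reasoning
    eval-3^q⊗e′ : eval (3^ q ⊗ e′) ≡ 3 ^ k * (3 ^ q * m)
    eval-3^q⊗e′ = begin-equality
      eval (3^ q ⊗ e′)       ≡⟨ eval-3^⊗ q e′ ⟩
      3 ^ q * eval e′        ≡⟨ cong (3 ^ q *_) eval-e′ ⟩
      3 ^ q * (3 ^ k * m)    ≡⟨ x∙yz≈y∙xz (3 ^ q) (3 ^ k) m ⟩
      3 ^ k * (3 ^ q * m)    ∎

prime[3] : Prime 3
prime[3] = from-yes (prime? 3)

proposition3p1 : (n m : ℕ) → 0 < n → 0 < m → (cn cm : ℕ) →
    IsComplexity n cn → IsComplexity m cm → SameDefect n m cn cm →
    Stable n → Stable m
proposition3p1 n m 0<n 0<m cn cm ‖n‖ ‖m‖ same-defect n-stable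
  with p^a*x^k≡p^b*y^k⇒y≡p^q*x∨x≡p^q*y prime[3] 3 {a = cn} {b = cm}
         {{>-nonZero 0<m}} {{>-nonZero 0<n}} same-defect
... | q , inj₁ (refl , refl) = stable-3^*⇒stable q ‖m‖ ‖n‖ n-stable
... | q , inj₂ (refl , refl) = stable⇒stable-3^* q ‖n‖ ‖m‖ n-stable
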